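{- Let $n \ge 5$ and let $A \in \mathbb{F}^{n\times n}$ satisfy property $\mathcal{R}$. Let $i \in [n]$, let $X \subseteq [n]\setminus\{i\}$ be a cut of the matrix $A[[n]\setminus\{i\}]$, and let $\overline{X} = [n] \setminus (X \cup \{i\})$. Then $\mathrm{rank}\, A[X\cup\{i\}, \overline{X}] = 1$ or $\mathrm{rank}\, A[X, \overline{X}\cup\{i\}] = 1$, and $\mathrm{rank}\, A[\overline{X}\cup\{i\}, X] = 1$ or $\mathrm{rank}\, A[\overline{X}, X\cup\{i\}] = 1$.
   Context: For a matrix $M$ with rows and columns indexed by a finite set $I$ and $S,T\subseteq I$, $M[S,T]$ is the submatrix with rows indexed by $S$ and columns by $T$, $M[S]=M[S,S]$, $\overline{S}=I\setminus S$. If $|I| \ge 4$, a subset $X \subseteq I$ is a cut of $M$ if $2 \le |X| \le |I|-2$ and both $M[X, I\setminus X]$ and $M[I\setminus X, X]$ have rank at most one. A matrix $M\in\mathbb{F}^{n\times n}$ satisfies property $\mathcal{R}$ if (i) all off-diagonal entries are nonzero, and (ii) whenever $i,j,k,\ell\in[n]$ are distinct with $\mathrm{rank}(M[\{i,j\},\{k,\ell\}])=1$, there exists $S\subseteq[n]$ with $i,j\in S$, $k,\ell\in\overline{S}$ and $\mathrm{rank}(M[S,\overline{S}])=1$. -}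

module Defs where

open import Level using (Level; _⊔_; suc)
open import Algebra.Bundles using (CommutativeRing)
open import Data.Nat using (ℕ; zero; _+_; _≤_) renaming (suc to sucℕ)
open import Data.Fin using (Fin) renaming (zero to fzero; suc to fsuc)
open import Data.Fin.Subset using (Subset; _∈_; _∉_; _⊆_; ∁; _─_; _∪_; ⁅_⁆; ∣_∣)
open import Data.Product using (Σ; ∃; _×_; _,_)
open import Relation.Binary.PropositionalEquality using (_≢_)
open import Relation.Nullary using (¬_)

record Field (c ℓ : Level) : Set (suc (c ⊔ ℓ)) where
  field
    commutativeRing : CommutativeRing c ℓ
  open CommutativeRing commutativeRing public
  field
    1≉0     : ¬ (1# ≈ 0#)
    inverse : ∀ x → ¬ (x ≈ 0#) → Σ Carrier (λ y → (x * y) ≈ 1#)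

module _ {c ℓ : Level} (F : Field c ℓ) where
  open Field F using (Carrier; _≈_; 0#) renaming (_+_ to _+F_; _*_ to _*F_)

  Matrix : ℕ → Set c
  Matrix n = Fin n → Fin n → Carrier

  ∑ : (r : ℕ) → (Fin r → Carrier) → Carrier
  ∑ zero     f = 0#
  ∑ (sucℕ r) f = f fzero +F ∑ r (λ k → f (fsuc k))

  -- rank M[S,T] ≤ r : the submatrix M[S,T] factors as U V with inner
  -- dimension r (rank = minimal inner dimension of a factorization).
  RankAtMost : {n : ℕ} → ℕ → Matrix n → Subset n → Subset n → Set (c ⊔ ℓ)
  RankAtMost {n} r M S T =
    Σ (Fin n → Fin r → Carrier) λ U →
    Σ (Fin r → Fin n → Carrier) λ V →
      ∀ s t → s ∈ S → t ∈ T → M s t ≈ ∑ r (λ k → U s k *F V k t)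

  HasRank : {n : ℕ} → ℕ → Matrix n → Subset n → Subset n → Set (c ⊔ ℓ)
  HasRank zero     M S T = RankAtMost zero M S T
  HasRank (sucℕ r) M S T = RankAtMost (sucℕ r) M S T × ¬ RankAtMost r M S T

  IsCut : {n : ℕ} → Matrix n → Subset n → Subset n → Set (c ⊔ ℓ)
  IsCut M I X =
    (4 ≤ ∣ I ∣) × (X ⊆ I) × (2 ≤ ∣ X ∣) × (∣ X ∣ + 2 ≤ ∣ I ∣) ×
    RankAtMost 1 M X (I ─ X) × RankAtMost 1 M (I ─ X) X

  PropertyR : {n : ℕ} → Matrix n → Set (c ⊔ ℓ)
  PropertyR {n} M =
    (∀ (i j : Fin n) → i ≢ j → ¬ (M i j ≈ 0#)) ×
    (∀ (i j k l : Fin n) → i ≢ j → i ≢ k → i ≢ l → j ≢ k → j ≢ l → k ≢ l →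
       HasRank 1 M (⁅ i ⁆ ∪ ⁅ j ⁆) (⁅ k ⁆ ∪ ⁅ l ⁆) →
       ∃ λ (S : Subset n) → i ∈ S × j ∈ S × k ∉ S × l ∉ S ×
         HasRank 1 M S (∁ S))

-- For s ≠ s' in X and t ≠ t' in X̄ the minor A[{s,s'},{t,t'}] has rank one, so property R
-- yields a set S ⊇ {s,s'} avoiding {t,t'} with rank A[S, S̄] = 1. If i ∈ S, row i is
-- proportional to row s on the columns t, t'; if i ∉ S, column i is proportional to column t
-- on the rows s, s'. Either the first alternative occurs for every pair {t,t'}, and then row i
-- can be adjoined to the rank-one block A[X, X̄], or it fails for some pair, and then the
-- second one holds for every pair {s,s'}, so column i can be adjoined. Since X and X̄ are
-- finite, this dichotomy is constructive. Applying the argument to the transpose gives the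
-- second conjunct.
module Submission where

open import Defs
open import Level using (Level)
open import Data.Nat using (ℕ; _≤_)
open import Data.Fin using (Fin)
open import Data.Fin.Subset using (Subset; _∪_; ∁; ⁅_⁆; _-_)
open import Data.Product using (_×_)
open import Data.Sum using (_⊎_)

open import Data.Nat using (zero; suc; _<_; s≤s; z≤n) renaming (_+_ to _+ℕ_)
open import Data.Nat.Properties using (≤-trans; <-≤-trans; <⇒≱; >⇒≢; m<m+n)
open import Data.Fin using () renaming (zero to fzero; suc to fsuc)
open import Data.Fin.Properties using (_≟_; ∀-cons)
open import Data.Fin.Subset using (_∈_; _∉_; _⊆_; _─_; ∣_∣; Nonempty)
open import Data.Fin.Subset.Properties
  using (_∈?_; nonempty?; Empty-unique; ∣⊥∣≡0; p⊆q⇒∣p∣≤∣q∣; p⊆p∪q; x∈p∪q⁻; x∈p∪q⁺; x∈⁅x⁆;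
         x∈⁅y⁆⇒x≡y; x∈p⇒x∉∁p; x∈∁p⇒x∉p; x∉p⇒x∈∁p; x∉∁p⇒x∈p; x∈p∧x∉q⇒x∈p─q)
open import Data.Product using (∃; _,_; proj₁)
open import Data.Sum using (inj₁; inj₂; [_,_]) renaming (map to ⊎-map; map₁ to ⊎-map₁; map₂ to ⊎-map₂; swap to ⊎-swap)
open import Function using (_∘_; id)
open import Relation.Nullary using (Dec; yes; no; contradiction)
open import Relation.Nullary.Decidable using (¬?)
open import Relation.Binary.PropositionalEquality using (_≡_; _≢_; refl)
import Relation.Binary.PropositionalEquality as ≡
import Relation.Binary.Reasoning.Setoid as SetoidReasoning
import Algebra.Properties.CommutativeSemigroup as CommutativeSemigroupProperties

module _ {a b c : Level} {A : Set a} where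

  →-distribˡ-⊎ : {B : Set b} {C : Set c} → Dec A → (A → B ⊎ C) → B ⊎ (A → C)
  →-distribˡ-⊎ (yes a) f = ⊎-map₂ (λ c _ → c) (f a)
  →-distribˡ-⊎ (no ¬a) f = inj₂ (λ a → contradiction a ¬a)

  →-distribʳ-⊎ : {B : Set b} {C : Set c} → Dec A → (A → B ⊎ C) → (A → B) ⊎ C
  →-distribʳ-⊎ (yes a) f = ⊎-map₁ (λ b _ → b) (f a)
  →-distribʳ-⊎ (no ¬a) f = inj₁ (λ a → contradiction a ¬a)

-- Constructive only because j ranges over a finite type.
module _ {b c : Level} where

  ∀-distribˡ-⊎ : ∀ {k} {B : Set b} {C : Fin k → Set c} → (∀ j → B ⊎ C j) → B ⊎ (∀ j → C j)
  ∀-distribˡ-⊎ {zero}  f = inj₂ λ ()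
  ∀-distribˡ-⊎ {suc k} f with f fzero | ∀-distribˡ-⊎ (f ∘ fsuc)
  ... | inj₁ b | _       = inj₁ b
  ... | inj₂ _ | inj₁ b  = inj₁ b
  ... | inj₂ c | inj₂ cs = inj₂ (∀-cons c cs)

  ∀-distribʳ-⊎ : ∀ {k} {B : Set b} {C : Fin k → Set c} → (∀ j → C j ⊎ B) → (∀ j → C j) ⊎ B
  ∀-distribʳ-⊎ f = ⊎-swap (∀-distribˡ-⊎ (⊎-swap ∘ f))

∈-∪-⁅⁆⁻ : ∀ {n} (S : Subset n) (r : Fin n) {x} → x ∈ S ∪ ⁅ r ⁆ → x ∈ S ⊎ x ≡ r
∈-∪-⁅⁆⁻ S r = ⊎-map₂ (x∈⁅y⁆⇒x≡y r) ∘ x∈p∪q⁻ S ⁅ r ⁆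

∉-∪ : ∀ {n} {S T : Subset n} {x} → x ∉ S → x ∉ T → x ∉ S ∪ T
∉-∪ {S = S} {T} x∉S x∉T = [ x∉S , x∉T ] ∘ x∈p∪q⁻ S T

pair⊆ : ∀ {n} {S : Subset n} {x y} → x ∈ S → y ∈ S → ⁅ x ⁆ ∪ ⁅ y ⁆ ⊆ S
pair⊆ {x = x} {y} x∈S y∈S z∈ with ∈-∪-⁅⁆⁻ ⁅ x ⁆ y z∈
... | inj₁ z∈⁅x⁆ = ≡.subst (_∈ _) (≡.sym (x∈⁅y⁆⇒x≡y x z∈⁅x⁆)) x∈S
... | inj₂ refl  = y∈S

x∈pair : ∀ {n} (x y : Fin n) → x ∈ ⁅ x ⁆ ∪ ⁅ y ⁆
x∈pair x y = x∈p∪q⁺ (inj₁ (x∈⁅x⁆ x))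

0<∣p∣⇒Nonempty : ∀ {n} {S : Subset n} → 0 < ∣ S ∣ → Nonempty S
0<∣p∣⇒Nonempty {n} {S} 0<∣S∣ with nonempty? S
... | yes ne = ne
... | no ¬ne = contradiction (≡.trans (≡.cong ∣_∣ (Empty-unique ¬ne)) (∣⊥∣≡0 n)) (>⇒≢ 0<∣S∣)

∁[p∪q]⊆∁q─p : ∀ {n} (S T : Subset n) → ∁ (S ∪ T) ⊆ ∁ T ─ S
∁[p∪q]⊆∁q─p S T x∈ = x∈p∧x∉q⇒x∈p─q (x∉p⇒x∈∁p (x∉S∪T ∘ x∈p∪q⁺ ∘ inj₂)) (x∉S∪T ∘ x∈p∪q⁺ ∘ inj₁)
  where x∉S∪T = x∈∁p⇒x∉p x∈

∣p∣<∣∁q∣⇒Nonempty∁[p∪q] : ∀ {n} {S T : Subset n} → ∣ S ∣ < ∣ ∁ T ∣ → Nonempty (∁ (S ∪ T))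
∣p∣<∣∁q∣⇒Nonempty∁[p∪q] {S = S} {T} ∣S∣<∣∁T∣ with nonempty? (∁ (S ∪ T))
... | yes ne = ne
... | no ¬ne = contradiction (p⊆q⇒∣p∣≤∣q∣ ∁T⊆S) (<⇒≱ ∣S∣<∣∁T∣)
  where
  ∁T⊆S : ∁ T ⊆ S
  ∁T⊆S {x} x∈∁T with x ∈? S
  ... | yes x∈S = x∈S
  ... | no x∉S  = contradiction (x , x∉p⇒x∈∁p (∉-∪ x∉S (x∈∁p⇒x∉p x∈∁T))) ¬ne

module _ {c ℓ : Level} (F : Field c ℓ) where
  open Field F renaming (refl to ≈-refl)
  open SetoidReasoning setoid
  open CommutativeSemigroupProperties *-commutativeSemigroup using (interchange)

  *-cancelʳ-nonzero : ∀ {x y d} → x * d ≈ y * d → d ≉ 0# → x ≈ y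
  *-cancelʳ-nonzero {x} {y} {d} xd≈yd d≉0 with inverse d d≉0
  ... | e , de≈1 = begin
    x           ≈⟨ sym (*-identityʳ x) ⟩
    x * 1#      ≈⟨ *-congˡ (sym de≈1) ⟩
    x * (d * e) ≈⟨ sym (*-assoc x d e) ⟩
    (x * d) * e ≈⟨ *-congʳ xd≈yd ⟩
    (y * d) * e ≈⟨ *-assoc y d e ⟩
    y * (d * e) ≈⟨ *-congˡ de≈1 ⟩
    y * 1#      ≈⟨ *-identityʳ y ⟩
    y           ∎

  *-swapʳ : ∀ x y z → (x * y) * z ≈ (x * z) * y
  *-swapʳ x y z = begin
    (x * y) * z ≈⟨ *-assoc x y z ⟩
    x * (y * z) ≈⟨ *-congˡ (*-comm y z) ⟩
    x * (z * y) ≈⟨ sym (*-assoc x z y) ⟩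
    (x * z) * y ∎

  cross-trans : ∀ {a b c d e f} → a * d ≈ b * c → c * f ≈ d * e → d ≉ 0# → a * f ≈ b * e
  cross-trans {a} {b} {c} {d} {e} {f} ad≈bc cf≈de d≉0 = *-cancelʳ-nonzero (begin
    (a * f) * d ≈⟨ *-swapʳ a f d ⟩
    (a * d) * f ≈⟨ *-congʳ ad≈bc ⟩
    (b * c) * f ≈⟨ *-assoc b c f ⟩
    b * (c * f) ≈⟨ *-congˡ cf≈de ⟩
    b * (d * e) ≈⟨ sym (*-assoc b d e) ⟩
    (b * d) * e ≈⟨ *-swapʳ b d e ⟩
    (b * e) * d ∎) d≉0

  module _ {n : ℕ} where

    transpose : Matrix F n → Matrix F n
    transpose M s t = M t s

    MinorVanishes : Matrix F n → (r s t t' : Fin n) → Set ℓ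
    MinorVanishes M r s t t' = M r t * M s t' ≈ M r t' * M s t

    MinorsVanish : Matrix F n → Subset n → Subset n → Set ℓ
    MinorsVanish M S T = ∀ {r s t t'} → r ∈ S → s ∈ S → t ∈ T → t' ∈ T → MinorVanishes M r s t t'

    minorVanishes-sameRow : ∀ M r t t' → MinorVanishes M r r t t'
    minorVanishes-sameRow M r t t' = *-comm (M r t) (M r t')

    minorVanishes-swapRows : ∀ {M r s t t'} → MinorVanishes M r s t t' → MinorVanishes M s r t t'
    minorVanishes-swapRows {M} {r} {s} {t} {t'} v =
      sym (trans (*-comm (M s t') (M r t)) (trans v (*-comm (M r t') (M s t))))

    minorVanishes-transpose : ∀ {M r s t t'} → MinorVanishes M r s t t' →
                              MinorVanishes (transpose M) t t' r s
    minorVanishes-transpose {M} {r} {s} {t} {t'} v = trans v (*-comm (M r t') (M s t))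

    minorsVanish-mono : ∀ {M S T S' T'} → MinorsVanish M S T → S' ⊆ S → T' ⊆ T → MinorsVanish M S' T'
    minorsVanish-mono v S'⊆S T'⊆T r∈ s∈ t∈ t'∈ = v (S'⊆S r∈) (S'⊆S s∈) (T'⊆T t∈) (T'⊆T t'∈)

    minorsVanish-transpose : ∀ {M S T} → MinorsVanish M S T → MinorsVanish (transpose M) T S
    minorsVanish-transpose {M} v t∈ t'∈ r∈ s∈ = minorVanishes-transpose {M} (v r∈ s∈ t∈ t'∈)

    rankAtMost1⇒minorsVanish : ∀ {M S T} → RankAtMost F 1 M S T → MinorsVanish M S T
    rankAtMost1⇒minorsVanish {M} (U , V , M≈UV) {r} {s} {t} {t'} r∈ s∈ t∈ t'∈ = begin
      M r t * M s t'                   ≈⟨ *-cong (entry r∈ t∈) (entry s∈ t'∈) ⟩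
      (u r * v t) * (u s * v t')       ≈⟨ interchange (u r) (v t) (u s) (v t') ⟩
      (u r * u s) * (v t * v t')       ≈⟨ *-congˡ (*-comm (v t) (v t')) ⟩
      (u r * u s) * (v t' * v t)       ≈⟨ sym (interchange (u r) (v t') (u s) (v t)) ⟩
      (u r * v t') * (u s * v t)       ≈⟨ sym (*-cong (entry r∈ t'∈) (entry s∈ t∈)) ⟩
      M r t' * M s t                   ∎
      where
      u = λ x → U x fzero
      v = λ y → V fzero y
      entry : ∀ {x y} → x ∈ _ → y ∈ _ → M x y ≈ u x * v y
      entry x∈ y∈ = trans (M≈UV _ _ x∈ y∈) (+-identityʳ _)

    -- A factorization through the row of s₀ and the column of t₀, rescaled by 1 / M s₀ t₀.
    minorsVanish⇒hasRank1 : ∀ {M S T s₀ t₀} → MinorsVanish M S T → s₀ ∈ S → t₀ ∈ T →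
                            M s₀ t₀ ≉ 0# → HasRank F 1 M S T
    minorsVanish⇒hasRank1 {M} {S} {T} {s₀} {t₀} v s₀∈ t₀∈ m≉0 with inverse (M s₀ t₀) m≉0
    ... | e , me≈1 = ((λ s _ → M s t₀) , (λ _ t → M s₀ t * e) , factor) , λ (_ , _ , M≈0) → m≉0 (M≈0 _ _ s₀∈ t₀∈)
      where
      factor : ∀ s t → s ∈ S → t ∈ T → M s t ≈ M s t₀ * (M s₀ t * e) + 0#
      factor s t s∈ t∈ = begin
        M s t                     ≈⟨ sym (*-identityʳ _) ⟩
        M s t * 1#                ≈⟨ *-congˡ (sym me≈1) ⟩
        M s t * (M s₀ t₀ * e)     ≈⟨ sym (*-assoc _ _ _) ⟩
        (M s t * M s₀ t₀) * e     ≈⟨ *-congʳ (v s∈ s₀∈ t∈ t₀∈) ⟩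
        (M s t₀ * M s₀ t) * e     ≈⟨ *-assoc _ _ _ ⟩
        M s t₀ * (M s₀ t * e)     ≈⟨ sym (+-identityʳ _) ⟩
        M s t₀ * (M s₀ t * e) + 0# ∎

    minorVanishes-tiedRow : ∀ {M S T} (r : Fin n) → MinorsVanish M S T →
      (∀ {s t} → s ∈ S → t ∈ T → M s t ≉ 0#) →
      (∀ {t t'} → t ∈ T → t' ∈ T → t ≢ t' → ∃ λ s → s ∈ S × MinorVanishes M r s t t') →
      ∀ {s t t'} → s ∈ S → t ∈ T → t' ∈ T → MinorVanishes M r s t t'
    minorVanishes-tiedRow r v nonzero tied {s} {t} {t'} s∈ t∈ t'∈ with t ≟ t'
    ... | yes refl = ≈-refl
    ... | no t≢t' with tied t∈ t'∈ t≢t'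
    ...   | s₀ , s₀∈ , v₀ = cross-trans v₀ (v s₀∈ s∈ t∈ t'∈) (nonzero s₀∈ t'∈)

    minorsVanish-adjoinRow : ∀ {M S T} (r : Fin n) → MinorsVanish M S T →
      (∀ {s t} → s ∈ S → t ∈ T → M s t ≉ 0#) →
      (∀ {t t'} → t ∈ T → t' ∈ T → t ≢ t' → ∃ λ s → s ∈ S × MinorVanishes M r s t t') →
      MinorsVanish M (S ∪ ⁅ r ⁆) T
    minorsVanish-adjoinRow {M} {S} r v nonzero tied r∈ s∈ t∈ t'∈
      with ∈-∪-⁅⁆⁻ S r r∈ | ∈-∪-⁅⁆⁻ S r s∈
    ... | inj₁ r∈S | inj₁ s∈S = v r∈S s∈S t∈ t'∈
    ... | inj₂ refl | inj₁ s∈S = minorVanishes-tiedRow r v nonzero tied s∈S t∈ t'∈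
    ... | inj₁ r∈S | inj₂ refl = minorVanishes-swapRows {M} (minorVanishes-tiedRow r v nonzero tied r∈S t∈ t'∈)
    ... | inj₂ refl | inj₂ refl = minorVanishes-sameRow M r _ _

    minorsVanish-adjoinColumn : ∀ {M S T} (c : Fin n) → MinorsVanish M S T →
      (∀ {s t} → s ∈ S → t ∈ T → M s t ≉ 0#) →
      (∀ {s s'} → s ∈ S → s' ∈ S → s ≢ s' → ∃ λ t → t ∈ T × MinorVanishes M s s' c t) →
      MinorsVanish M S (T ∪ ⁅ c ⁆)
    minorsVanish-adjoinColumn {M} c v nonzero tied =
      minorsVanish-transpose (minorsVanish-adjoinRow c (minorsVanish-transpose v)
        (λ t∈ s∈ → nonzero s∈ t∈)
        (λ s∈ s'∈ s≢s' → let t , t∈ , w = tied s∈ s'∈ s≢s' in t , t∈ , minorVanishes-transpose {M} w))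

    Separated : Matrix F n → (s s' t t' : Fin n) → Set ℓ
    Separated M s s' t t' =
      ∃ λ S → s ∈ S × s' ∈ S × t ∉ S × t' ∉ S × MinorsVanish M S (∁ S)

    separated⇒rowOrColumn : ∀ {M s s' t t'} → Separated M s s' t t' → (r : Fin n) →
                            MinorVanishes M r s t t' ⊎ MinorVanishes M s s' r t
    separated⇒rowOrColumn (S , s∈ , s'∈ , t∉ , t'∉ , v) r with r ∈? S
    ... | yes r∈ = inj₁ (v r∈ s∈ (x∉p⇒x∈∁p t∉) (x∉p⇒x∈∁p t'∉))
    ... | no r∉  = inj₂ (v s∈ s'∈ (x∉p⇒x∈∁p r∉) (x∉p⇒x∈∁p t∉))

    separated-transpose : ∀ {M s s' t t'} → Separated M t t' s s' → Separated (transpose M) s s' t t'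
    separated-transpose (S , t∈ , t'∈ , s∉ , s'∉ , v) =
      ∁ S , x∉p⇒x∈∁p s∉ , x∉p⇒x∈∁p s'∉ , x∈p⇒x∉∁p t∈ , x∈p⇒x∉∁p t'∈ ,
      minorsVanish-mono (minorsVanish-transpose v) id (x∉∁p⇒x∈p ∘ x∈∁p⇒x∉p)

    module _ {M : Matrix F n} {X Y : Subset n} (r : Fin n)
             (vanish : MinorsVanish M X Y)
             (nonzero : ∀ {s t} → s ∈ X → t ∈ Y → M s t ≉ 0#)
             (separated : ∀ {s s' t t'} → s ∈ X → s' ∈ X → t ∈ Y → t' ∈ Y → s ≢ s' → t ≢ t' →
                          Separated M s s' t t') where

      RowTied : Fin n → Fin n → Set ℓ
      RowTied t t' = ∃ λ s → s ∈ X × MinorVanishes M r s t t'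

      ColumnTied : Fin n → Set ℓ
      ColumnTied t = ∀ {s s'} → s ∈ X → s' ∈ X → MinorVanishes M s s' r t

      rowTiedOrColumnTied : ∀ {t t'} → t ∈ Y → t' ∈ Y → t ≢ t' → RowTied t t' ⊎ ColumnTied t
      rowTiedOrColumnTied {t} {t'} t∈ t'∈ t≢t' =
        ⊎-map₂ (λ (tied : ∀ s s' → s ∈ X → s' ∈ X → _) {s} {s'} → tied s s')
          (∀-distribˡ-⊎ λ s → ∀-distribˡ-⊎ (atPair s))
        where
        atRows : ∀ {s s'} → s ∈ X → s' ∈ X → RowTied t t' ⊎ MinorVanishes M s s' r t
        atRows {s} {s'} s∈ s'∈ with s ≟ s'
        ... | yes refl  = inj₂ (minorVanishes-sameRow M s r t)
        ... | no s≢s' = ⊎-map₁ (λ w → s , s∈ , w)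
                          (separated⇒rowOrColumn (separated s∈ s'∈ t∈ t'∈ s≢s' t≢t') r)

        atPair : ∀ s s' → RowTied t t' ⊎ (s ∈ X → s' ∈ X → MinorVanishes M s s' r t)
        atPair s s' = →-distribˡ-⊎ (s ∈? X) λ s∈ → →-distribˡ-⊎ (s' ∈? X) λ s'∈ → atRows s∈ s'∈

      everyRowTiedOrSomeColumnTied :
        (∀ {t t'} → t ∈ Y → t' ∈ Y → t ≢ t' → RowTied t t') ⊎ ∃ λ t → t ∈ Y × ColumnTied t
      everyRowTiedOrSomeColumnTied =
        ⊎-map₁ (λ tied {t} {t'} → tied t t')
          (∀-distribʳ-⊎ λ t → ∀-distribʳ-⊎ (atPair t))
        where
        atPair : ∀ t t' → (t ∈ Y → t' ∈ Y → t ≢ t' → RowTied t t') ⊎ ∃ λ t₀ → t₀ ∈ Y × ColumnTied t₀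
        atPair t t' =
          →-distribʳ-⊎ (t ∈? Y) λ t∈ → →-distribʳ-⊎ (t' ∈? Y) λ t'∈ → →-distribʳ-⊎ (¬? (t ≟ t')) λ t≢t' →
          ⊎-map₂ (λ (tied : ColumnTied t) → t , t∈ , tied) (rowTiedOrColumnTied t∈ t'∈ t≢t')

      rowOrColumn-adjoins : MinorsVanish M (X ∪ ⁅ r ⁆) Y ⊎ MinorsVanish M X (Y ∪ ⁅ r ⁆)
      rowOrColumn-adjoins =
        ⊎-map (minorsVanish-adjoinRow r vanish nonzero)
              (λ (t , t∈ , tied) → minorsVanish-adjoinColumn r vanish nonzero
                                      (λ s∈ s'∈ _ → t , t∈ , tied s∈ s'∈))
              everyRowTiedOrSomeColumnTied

    propertyR⇒separated : ∀ {A X Y s s' t t'} → PropertyR F A → (∀ {x} → x ∈ X → x ∉ Y) →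
      MinorsVanish A X Y → s ∈ X → s' ∈ X → t ∈ Y → t' ∈ Y → s ≢ s' → t ≢ t' → Separated A s s' t t'
    propertyR⇒separated {A} {X} {Y} {s} {s'} {t} {t'} (nonzero , split) disjoint v s∈ s'∈ t∈ t'∈ s≢s' t≢t' =
      let S , s∈S , s'∈S , t∉S , t'∉S , rank1 = split s s' t t' s≢s'
            (apart s∈ t∈) (apart s∈ t'∈) (apart s'∈ t∈) (apart s'∈ t'∈) t≢t' blockRank1
      in S , s∈S , s'∈S , t∉S , t'∉S , rankAtMost1⇒minorsVanish (proj₁ rank1)
      where
      apart : ∀ {x y} → x ∈ X → y ∈ Y → x ≢ y
      apart x∈ y∈ refl = disjoint x∈ y∈

      blockRank1 : HasRank F 1 A (⁅ s ⁆ ∪ ⁅ s' ⁆) (⁅ t ⁆ ∪ ⁅ t' ⁆)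
      blockRank1 = minorsVanish⇒hasRank1 (minorsVanish-mono v (pair⊆ s∈ s'∈) (pair⊆ t∈ t'∈))
                     (x∈pair s s') (x∈pair t t') (nonzero s t (apart s∈ t∈))

    module _ {A : Matrix F n} (propR : PropertyR F A) (i : Fin n) {X : Subset n}
             (2≤∣X∣ : 2 ≤ ∣ X ∣) (∣X∣+2≤ : ∣ X ∣ +ℕ 2 ≤ ∣ ∁ ⁅ i ⁆ ∣)
             (rankXY : RankAtMost F 1 A X (∁ ⁅ i ⁆ ─ X)) (rankYX : RankAtMost F 1 A (∁ ⁅ i ⁆ ─ X) X) where

      private
        Xbar : Subset n
        Xbar = ∁ (X ∪ ⁅ i ⁆)

        X∩Xbar : ∀ {x} → x ∈ X → x ∉ Xbar
        X∩Xbar x∈ = x∈p⇒x∉∁p (x∈p∪q⁺ (inj₁ x∈))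

        apart : ∀ {x y} → x ∈ X → y ∈ Xbar → x ≢ y
        apart x∈ y∈ refl = X∩Xbar x∈ y∈

        nonzero : ∀ {x y} → x ≢ y → A x y ≉ 0#
        nonzero = proj₁ propR _ _

        vanishXY : MinorsVanish A X Xbar
        vanishXY = minorsVanish-mono (rankAtMost1⇒minorsVanish rankXY) id (∁[p∪q]⊆∁q─p X ⁅ i ⁆)

        vanishYX : MinorsVanish A Xbar X
        vanishYX = minorsVanish-mono (rankAtMost1⇒minorsVanish rankYX) (∁[p∪q]⊆∁q─p X ⁅ i ⁆) id

        s₀∈X : ∃ λ s₀ → s₀ ∈ X
        s₀∈X = 0<∣p∣⇒Nonempty (≤-trans (s≤s z≤n) 2≤∣X∣)

        t₀∈Xbar : ∃ λ t₀ → t₀ ∈ Xbar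
        t₀∈Xbar = ∣p∣<∣∁q∣⇒Nonempty∁[p∪q] (<-≤-trans (m<m+n ∣ X ∣ (s≤s z≤n)) ∣X∣+2≤)

        hasRank1 : ∀ {S T} → X ⊆ S → Xbar ⊆ T → MinorsVanish A S T → HasRank F 1 A S T
        hasRank1 X⊆S Xbar⊆T v = let s₀ , s₀∈ = s₀∈X ; t₀ , t₀∈ = t₀∈Xbar in
          minorsVanish⇒hasRank1 v (X⊆S s₀∈) (Xbar⊆T t₀∈) (nonzero (apart s₀∈ t₀∈))

        hasRank1ᵀ : ∀ {S T} → Xbar ⊆ S → X ⊆ T → MinorsVanish A S T → HasRank F 1 A S T
        hasRank1ᵀ Xbar⊆S X⊆T v = let s₀ , s₀∈ = s₀∈X ; t₀ , t₀∈ = t₀∈Xbar in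
          minorsVanish⇒hasRank1 v (Xbar⊆S t₀∈) (X⊆T s₀∈) (nonzero (apart s₀∈ t₀∈ ∘ ≡.sym))

      rowOrColumnJoinsCut : HasRank F 1 A (X ∪ ⁅ i ⁆) Xbar ⊎ HasRank F 1 A X (Xbar ∪ ⁅ i ⁆)
      rowOrColumnJoinsCut =
        ⊎-map (hasRank1 (p⊆p∪q _) id) (hasRank1 id (p⊆p∪q _))
          (rowOrColumn-adjoins i vanishXY (λ s∈ t∈ → nonzero (apart s∈ t∈)) (propertyR⇒separated propR X∩Xbar vanishXY))

      columnOrRowJoinsCut : HasRank F 1 A (Xbar ∪ ⁅ i ⁆) X ⊎ HasRank F 1 A Xbar (X ∪ ⁅ i ⁆)
      columnOrRowJoinsCut =
        ⊎-swap (⊎-map (hasRank1ᵀ id (p⊆p∪q _) ∘ minorsVanish-transpose)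
                      (hasRank1ᵀ (p⊆p∪q _) id ∘ minorsVanish-transpose)
          (rowOrColumn-adjoins {M = transpose A} i (minorsVanish-transpose vanishYX)
             (λ s∈ t∈ → nonzero (apart s∈ t∈ ∘ ≡.sym))
             (λ s∈ s'∈ t∈ t'∈ s≢s' t≢t' → separated-transpose
                (propertyR⇒separated propR (λ y∈ x∈ → X∩Xbar x∈ y∈) vanishYX t∈ t'∈ s∈ s'∈ t≢t' s≢s'))))

lemma5p3 : {c ℓ : Level} (F : Field c ℓ) (n : ℕ) → 5 ≤ n →
    (A : Matrix F n) → PropertyR F A →
    (i : Fin n) (X : Subset n) → IsCut F A (∁ ⁅ i ⁆) X →
    let Xbar = ∁ (X ∪ ⁅ i ⁆) in
    (HasRank F 1 A (X ∪ ⁅ i ⁆) Xbar ⊎ HasRank F 1 A X (Xbar ∪ ⁅ i ⁆)) ×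
    (HasRank F 1 A (Xbar ∪ ⁅ i ⁆) X ⊎ HasRank F 1 A Xbar (X ∪ ⁅ i ⁆))
lemma5p3 F n _ A propR i X (_ , _ , 2≤∣X∣ , ∣X∣+2≤ , rankXY , rankYX) =
  rowOrColumnJoinsCut F propR i 2≤∣X∣ ∣X∣+2≤ rankXY rankYX ,
  columnOrRowJoinsCut F propR i 2≤∣X∣ ∣X∣+2≤ rankXY rankYX
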